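{- Let $C$ be a cyclically ordered graph with at least one edge. Then $ssat_{\circlearrowright}(n,C)=O(1)$ if $C$ contains a minedge, and $ssat_{\circlearrowright}(n,C)=\Theta(n)$ otherwise.
   Context: A cyclically ordered graph is a finite simple graph whose vertex set is cyclically ordered. For vertices $u,x,v$ write $u<x<v$ if going clockwise from $u$ one meets $x$ before $v$; $I_{u,v}=\{x:u<x<v\}$. A copy of $C$ in $H$ is given by an injective cyclic-order-preserving map $\varphi:V(C)\to V(H)$ with $\varphi(u)\varphi(v)\in E(H)$ for all $uv\in E(C)$. $H$ semisaturates $C$ if for every pair of distinct non-adjacent vertices $x,y$ of $H$, $H+xy$ contains a copy of $C$ not contained in $H$. $ssat_{\circlearrowright}(n,C)$ is the minimum number of edges of a cyclically ordered graph on $n$ vertices semisaturating $C$. An edge $uv$ of $C$ is a minedge if $I_{u,v}$ or $I_{v,u}$ is empty and both $u,v$ have degree one. -}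

module Defs where

open import Data.Nat using (ℕ; zero; suc; _+_; _*_; _≤_)
open import Data.Fin using (Fin; _<_; _<?_; _≟_)
open import Data.Bool using (Bool; true; false; _∧_; _∨_; if_then_else_)
open import Data.List using (List; map; allFin)
open import Data.Nat.ListAction using (sum)
open import Data.Product using (Σ; ∃; _×_; _,_)
open import Data.Sum using (_⊎_)
open import Relation.Nullary using (¬_)
open import Relation.Nullary.Decidable using (⌊_⌋)
open import Relation.Binary.PropositionalEquality using (_≡_; _≢_)

-- Every cyclically ordered set
-- of size k is isomorphic to Fin k with the cyclic order 0 → 1 → … → k-1 → 0,
-- so the vertex set is Fin k with that cyclic order.
record COGraph (k : ℕ) : Set where
  field
    adj   : Fin k → Fin k → Bool
    sym   : ∀ u v → adj u v ≡ adj v u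
    irrefl : ∀ u → adj u u ≡ false
open COGraph public

-- Cyclic betweenness: u < x < v  iff going clockwise from u one meets x before v.
-- (All three vertices are then pairwise distinct.)
Betw : ∀ {k} → Fin k → Fin k → Fin k → Set
Betw u x v = (u < x × x < v) ⊎ (x < v × v < u) ⊎ (v < u × u < x)

addEdge : ∀ {n} → (Fin n → Fin n → Bool) → Fin n → Fin n → (Fin n → Fin n → Bool)
addEdge A x y a b = A a b ∨ (⌊ a ≟ x ⌋ ∧ ⌊ b ≟ y ⌋) ∨ (⌊ a ≟ y ⌋ ∧ ⌊ b ≟ x ⌋)

IsCopy : ∀ {k n} → COGraph k → (Fin n → Fin n → Bool) → (Fin k → Fin n) → Set
IsCopy {k} C A φ =
  (∀ u v → φ u ≡ φ v → u ≡ v)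
  × (∀ u x v → Betw u x v → Betw (φ u) (φ x) (φ v))
  × (∀ u v → adj C u v ≡ true → A (φ u) (φ v) ≡ true)

Semisaturates : ∀ {n k} → COGraph n → COGraph k → Set
Semisaturates {n} {k} H C =
  ∀ (x y : Fin n) → x ≢ y → adj H x y ≡ false →
    Σ (Fin k → Fin n) λ φ → IsCopy C (addEdge (adj H) x y) φ × ¬ IsCopy C (adj H) φ

count : ∀ {n} → (Fin n → Bool) → ℕ
count {n} p = sum (map (λ i → if p i then 1 else 0) (allFin n))

edges : ∀ {n} → COGraph n → ℕ
edges {n} H = sum (map (λ i → count (λ j → ⌊ i <? j ⌋ ∧ adj H i j)) (allFin n))

degree : ∀ {k} → COGraph k → Fin k → ℕ
degree C u = count (adj C u)

IntervalEmpty : ∀ {k} → Fin k → Fin k → Set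
IntervalEmpty u v = ∀ x → ¬ Betw u x v

IsMinedge : ∀ {k} → COGraph k → Fin k → Fin k → Set
IsMinedge C u v =
  adj C u v ≡ true × (IntervalEmpty u v ⊎ IntervalEmpty v u)
  × degree C u ≡ 1 × degree C v ≡ 1

HasMinedge : ∀ {k} → COGraph k → Set
HasMinedge C = ∃ λ u → ∃ λ v → IsMinedge C u v

HasEdge : ∀ {k} → COGraph k → Set
HasEdge C = ∃ λ u → ∃ λ v → adj C u v ≡ true

-- ssat(n,C) = O(1): some constant bounds, for every n, the minimum number of
-- edges of an n-vertex semisaturating graph.
SsatBounded : ∀ {k} → COGraph k → Set
SsatBounded C = ∃ λ c → ∀ n → Σ (COGraph n) λ H → Semisaturates H C × edges H ≤ c

SsatUpperLinear : ∀ {k} → COGraph k → Set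
SsatUpperLinear C = ∃ λ c → ∃ λ n₀ → ∀ n → n₀ ≤ n →
  Σ (COGraph n) λ H → Semisaturates H C × edges H ≤ c * n

-- ssat(n,C) = Ω(n): n ≤ d · ssat(n,C) for all large n, i.e. every
-- semisaturating H on n vertices has at least n/d edges.
SsatLowerLinear : ∀ {k} → COGraph k → Set
SsatLowerLinear C = ∃ λ d → ∃ λ n₀ → ∀ n → n₀ ≤ n →
  ∀ (H : COGraph n) → Semisaturates H C → n ≤ d * edges H

-- If uv is a minedge with I_{u,v} empty, a clique on the first 2(k-2) vertices semisaturates C.
-- For a non-edge xy (x < y, so y lies beyond the clique) we place u, v on x, y and the other
-- k-2 vertices of C inside the clique, all before x if there is room and otherwise all
-- between x and y; since u and v have degree one, uv is the only edge of C that does not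
-- land in the clique.  Without a minedge we take an edge uv of minimal clockwise length ℓ,
-- join every vertex to the first k-1-ℓ vertices and join vertices at distance less than ℓ.
-- This graph has O(n) edges, and the same placement works for a non-edge xy with y - x ≥ ℓ:
-- by minimality uv is the only edge of C among u, v and the vertices between them, and every
-- other edge has an endpoint placed among the first k-1-ℓ vertices.  Conversely, in H + xy with
-- x, y consecutive and isolated, a new copy of C must map an edge onto xy, and that edge is
-- a minedge.  So a semisaturating graph has no two consecutive isolated vertices, hence at
-- least about n/4 edges.
module Submission where

open import Data.Nat.Properties
open import Algebra.Properties.CommutativeMonoid.Sum +-0-commutativeMonoid
  using (sum-syntax; sum-cong-≗; ∑-distrib-+; ∑-comm)
open import Data.Bool using (Bool; true; false; _∧_; _∨_; if_then_else_; T)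
import Data.Bool.Properties as Bool
open import Data.Bool.Properties using (¬-not; ∨-comm; ∨-zeroʳ)
open import Data.Empty using (⊥-elim)
open import Data.Fin as Fin using (Fin; zero; suc; toℕ)
import Data.Fin.Properties as FinP
open import Data.Fin.Properties using (toℕ<n; toℕ-injective; toℕ-fromℕ<)
open import Data.List using (map; allFin; tabulate)
open import Data.List.Properties using (map-tabulate)
open import Data.Nat using (ℕ; zero; suc; _+_; _*_; _∸_; _≤_; _<_; z≤n; s≤s; z<s; _<ᵇ_; _≤?_; _<?_; _≟_)
import Data.Nat.ListAction as List
open import Data.Nat.Solver using (module +-*-Solver)
open import Data.Product using (Σ; ∃; _×_; _,_; proj₁; proj₂)
open import Data.Sum as Sum using (_⊎_; inj₁; inj₂)
open import Function using (id; _∘_; case_of_; _⇔_; mk⇔)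
open import Relation.Binary using (tri<; tri≈; tri>)
open import Relation.Binary.PropositionalEquality
open import Relation.Nullary using (¬_; Dec; yes; no)
open import Relation.Nullary.Decidable
  using (⌊_⌋; ¬?; _×-dec_; _⊎-dec_; _→-dec_; isYes≗does; dec-true; dec-false; does-⇔)

open import Defs renaming (sym to adj-sym; irrefl to adj-irrefl)

true≢false : true ≢ false
true≢false ()

∧-true : ∀ {b c} → b ∧ c ≡ true → b ≡ true × c ≡ true
∧-true {true} c≡true = refl , c≡true

⌊⌋-true : ∀ {p} {P : Set p} (P? : Dec P) → P → ⌊ P? ⌋ ≡ true
⌊⌋-true P? p = trans (isYes≗does P?) (dec-true P? p)

⌊⌋-false : ∀ {p} {P : Set p} (P? : Dec P) → ¬ P → ⌊ P? ⌋ ≡ false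
⌊⌋-false P? ¬p = trans (isYes≗does P?) (dec-false P? ¬p)

⌊⌋-true⁻¹ : ∀ {p} {P : Set p} (P? : Dec P) → ⌊ P? ⌋ ≡ true → P
⌊⌋-true⁻¹ (yes p) _ = p

⌊⌋-cong : ∀ {p q} {P : Set p} {Q : Set q} → P ⇔ Q → (P? : Dec P) (Q? : Dec Q) → ⌊ P? ⌋ ≡ ⌊ Q? ⌋
⌊⌋-cong P⇔Q P? Q? = trans (isYes≗does P?) (trans (does-⇔ P⇔Q P? Q?) (sym (isYes≗does Q?)))

-- Counting over Fin

listSum-allFin : ∀ n (f : Fin n → ℕ) → List.sum (map f (allFin n)) ≡ ∑[ i < n ] f i
listSum-allFin n f = trans (cong List.sum (map-tabulate id f)) (sum-tabulate n f)
  where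
  sum-tabulate : ∀ n (f : Fin n → ℕ) → List.sum (tabulate f) ≡ ∑[ i < n ] f i
  sum-tabulate zero    f = refl
  sum-tabulate (suc n) f = cong (f zero +_) (sum-tabulate n (f ∘ suc))

∑-mono-≤ : ∀ n {f g : Fin n → ℕ} → (∀ i → f i ≤ g i) → ∑[ i < n ] f i ≤ ∑[ i < n ] g i
∑-mono-≤ zero    f≤g = z≤n
∑-mono-≤ (suc n) f≤g = +-mono-≤ (f≤g zero) (∑-mono-≤ n (f≤g ∘ suc))

∑-threshold : ∀ n M c d →
  ∑[ i < n ] (if toℕ i <ᵇ M then c else d) ≤ M * c + n * d
∑-threshold zero    M       c d = z≤n
∑-threshold (suc n) zero    c d = +-monoʳ-≤ d (∑-threshold n zero c d)
∑-threshold (suc n) (suc M) c d = begin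
  c + ∑[ i < n ] (if toℕ i <ᵇ M then c else d) ≤⟨ +-monoʳ-≤ c (∑-threshold n M c d) ⟩
  c + (M * c + n * d)                           ≤⟨ +-monoʳ-≤ c (+-monoʳ-≤ (M * c) (m≤n+m (n * d) d)) ⟩
  c + (M * c + (d + n * d))                     ≡⟨ sym (+-assoc c (M * c) _) ⟩
  suc M * c + suc n * d                         ∎
  where open ≤-Reasoning

indicator : Bool → ℕ
indicator b = if b then 1 else 0

indicator≤1 : ∀ b → indicator b ≤ 1
indicator≤1 true  = ≤-refl
indicator≤1 false = z≤n

indicator-¬true : ∀ {b} → ¬ (b ≡ true) → indicator b ≡ 0
indicator-¬true {true}  ¬b≡true = ⊥-elim (¬b≡true refl)
indicator-¬true {false} _       = refl

count-∑ : ∀ {n} (p : Fin n → Bool) → count p ≡ ∑[ i < n ] indicator (p i)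
count-∑ {n} p = listSum-allFin n _

count-suc : ∀ {n} (p : Fin (suc n) → Bool) → count p ≡ indicator (p zero) + count (p ∘ suc)
count-suc p = trans (count-∑ p) (cong (indicator (p zero) +_) (sym (count-∑ (p ∘ suc))))

count-within : ∀ {n} a l (p : Fin n → Bool) →
  (∀ j → p j ≡ true → a ≤ toℕ j × toℕ j < a + l) → count p ≤ l
count-within {zero}  a       l       p inside = z≤n
count-within {suc n} zero    zero    p inside
  rewrite count-suc p | indicator-¬true (n≮0 ∘ proj₂ ∘ inside zero) =
  count-within 0 0 (p ∘ suc) λ j pj → ⊥-elim (n≮0 (proj₂ (inside (suc j) pj)))
count-within {suc n} zero    (suc l) p inside rewrite count-suc p =
  +-mono-≤ (indicator≤1 (p zero))
           (count-within 0 l (p ∘ suc) λ j pj → z≤n , ≤-pred (proj₂ (inside (suc j) pj)))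
count-within {suc n} (suc a) l       p inside
  rewrite count-suc p | indicator-¬true (n≮0 ∘ proj₁ ∘ inside zero) =
  count-within a l (p ∘ suc) λ j pj → let (a≤j , j<a+l) = inside (suc j) pj in ≤-pred a≤j , ≤-pred j<a+l

count-≤ : ∀ {n} (p : Fin n → Bool) → count p ≤ n
count-≤ {n} p = count-within 0 n p λ j _ → z≤n , toℕ<n j

count-pos : ∀ {n} (p : Fin n → Bool) a → p a ≡ true → 1 ≤ count p
count-pos {suc n} p zero    pa rewrite count-suc p | pa = s≤s z≤n
count-pos {suc n} p (suc a) pa rewrite count-suc p = ≤-trans (count-pos (p ∘ suc) a pa) (m≤n+m _ _)

count-pair : ∀ {n} (p : Fin n → Bool) a b → a ≢ b → p a ≡ true → p b ≡ true → 2 ≤ count p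
count-pair p zero    zero    a≢b pa pb = ⊥-elim (a≢b refl)
count-pair p zero    (suc b) a≢b pa pb rewrite count-suc p | pa = s≤s (count-pos (p ∘ suc) b pb)
count-pair p (suc a) zero    a≢b pa pb rewrite count-suc p | pb = s≤s (count-pos (p ∘ suc) a pa)
count-pair p (suc a) (suc b) a≢b pa pb rewrite count-suc p =
  ≤-trans (count-pair (p ∘ suc) a b (a≢b ∘ cong suc) pa pb) (m≤n+m _ _)

count≡0⇒false : ∀ {n} (p : Fin n → Bool) → count p ≡ 0 → ∀ a → p a ≡ false
count≡0⇒false p #p≡0 a = ¬-not λ pa → <-irrefl (sym #p≡0) (count-pos p a pa)

count≡1⇒unique : ∀ {n} (p : Fin n → Bool) → count p ≡ 1 →
  ∀ a b → p a ≡ true → p b ≡ true → a ≡ b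
count≡1⇒unique p #p≡1 a b pa pb with a Fin.≟ b
... | yes a≡b = a≡b
... | no  a≢b = ⊥-elim (<-irrefl (sym #p≡1) (count-pair p a b a≢b pa pb))

unique⇒count≡1 : ∀ {n} (p : Fin n → Bool) a → p a ≡ true →
  (∀ b → p b ≡ true → b ≡ a) → count p ≡ 1
unique⇒count≡1 p a pa unique = ≤-antisym (count-within (toℕ a) 1 p only-a) (count-pos p a pa)
  where
  only-a : ∀ j → p j ≡ true → toℕ a ≤ toℕ j × toℕ j < toℕ a + 1
  only-a j pj rewrite unique j pj = ≤-refl , m<m+n (toℕ a) z<s

forward : ∀ {n} → COGraph n → Fin n → Fin n → Bool
forward H i j = ⌊ i Fin.<? j ⌋ ∧ adj H i j

forwardDegree : ∀ {n} → COGraph n → Fin n → ℕ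
forwardDegree H i = count (forward H i)

edges-∑ : ∀ {n} (H : COGraph n) → edges H ≡ ∑[ i < n ] forwardDegree H i
edges-∑ {n} H = listSum-allFin n _

handshake : ∀ {n} (H : COGraph n) → ∑[ i < n ] degree H i ≤ 2 * edges H
handshake {n} H = begin
  ∑[ i < n ] degree H i                             ≡⟨ sum-cong-≗ (count-∑ ∘ adj H) ⟩
  ∑[ i < n ] ∑[ j < n ] indicator (adj H i j)       ≤⟨ ∑-mono-≤ n (∑-mono-≤ n ∘ counted-forward) ⟩
  ∑[ i < n ] ∑[ j < n ] (F i j + F j i)             ≡⟨ sum-cong-≗ (λ i → ∑-distrib-+ (F i) (λ j → F j i)) ⟩
  ∑[ i < n ] (∑[ j < n ] F i j + ∑[ j < n ] F j i)  ≡⟨ ∑-distrib-+ (λ i → ∑[ j < n ] F i j) _ ⟩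
  E + ∑[ i < n ] ∑[ j < n ] F j i                   ≡⟨ cong (E +_) (∑-comm (λ i j → F j i)) ⟩
  E + E                                             ≡⟨ cong (E +_) (sym (+-identityʳ E)) ⟩
  2 * E                                             ≡⟨ cong (2 *_) E≡edges ⟩
  2 * edges H                                       ∎
  where
  open ≤-Reasoning
  F : Fin n → Fin n → ℕ
  F i j = indicator (forward H i j)
  E : ℕ
  E = ∑[ i < n ] ∑[ j < n ] F i j
  E≡edges : E ≡ edges H
  E≡edges = trans (sym (sum-cong-≗ (count-∑ ∘ forward H))) (sym (edges-∑ H))
  counted-forward : ∀ i j → indicator (adj H i j) ≤ F i j + F j i
  counted-forward i j with FinP.<-cmp i j
  ... | tri< i<j _ _ = ≤-trans (≤-reflexive (cong (λ b → indicator (b ∧ adj H i j)) (sym (⌊⌋-true (i Fin.<? j) i<j))))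
                               (m≤m+n (F i j) (F j i))
  ... | tri≈ _ refl _ rewrite adj-irrefl H i = z≤n
  ... | tri> _ _ j<i = ≤-trans (≤-reflexive (cong₂ (λ b e → indicator (b ∧ e))
                                                   (sym (⌊⌋-true (j Fin.<? i) j<i)) (adj-sym H i j)))
                               (m≤n+m (F j i) (F i j))

edges-≤ : ∀ {n} (H : COGraph n) M c d →
  (∀ i → toℕ i < M → forwardDegree H i ≤ c) → (∀ i → M ≤ toℕ i → forwardDegree H i ≤ d) →
  edges H ≤ M * c + n * d
edges-≤ {n} H M c d low high = begin
  edges H                                  ≡⟨ edges-∑ H ⟩
  ∑[ i < n ] forwardDegree H i             ≤⟨ ∑-mono-≤ n bound ⟩
  ∑[ i < n ] (if toℕ i <ᵇ M then c else d) ≤⟨ ∑-threshold n M c d ⟩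
  M * c + n * d                            ∎
  where
  open ≤-Reasoning
  bound : ∀ i → forwardDegree H i ≤ (if toℕ i <ᵇ M then c else d)
  bound i with toℕ i <ᵇ M in i<ᵇM
  ... | true  = low i (<ᵇ⇒< (toℕ i) M (subst T (sym i<ᵇM) _))
  ... | false = high i (≮⇒≥ λ i<M → subst T i<ᵇM (<⇒<ᵇ i<M))

consecutive-cover : ∀ n (h : Fin (suc n) → ℕ) → (∀ i → 1 ≤ h (Fin.inject₁ i) + h (suc i)) →
  suc n ≤ 2 * ∑[ i < suc n ] h i + 1
consecutive-cover zero          h cover = m≤n+m 1 _
consecutive-cover (suc zero)    h cover =
  ≤-trans (*-monoʳ-≤ 2 (subst (1 ≤_) (cong (h zero +_) (sym (+-identityʳ _))) (cover zero))) (m≤m+n _ 1)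
consecutive-cover (suc (suc n)) h cover = begin
  2 + suc n                   ≤⟨ +-mono-≤ (*-monoʳ-≤ 2 (cover zero)) rest ⟩
  2 * (h₀ + h₁) + (2 * S + 1) ≡⟨ solve 3 (λ h₀ h₁ S → con 2 :* (h₀ :+ h₁) :+ (con 2 :* S :+ con 1)
                                                  := con 2 :* (h₀ :+ (h₁ :+ S)) :+ con 1) refl h₀ h₁ S ⟩
  2 * (h₀ + (h₁ + S)) + 1     ∎
  where
  open ≤-Reasoning
  open +-*-Solver
  h₀ h₁ S : ℕ
  h₀ = h zero
  h₁ = h (suc zero)
  S = ∑[ i < suc n ] h (suc (suc i))
  rest : suc n ≤ 2 * S + 1
  rest = consecutive-cover n (h ∘ Fin.suc ∘ Fin.suc) (cover ∘ Fin.suc ∘ Fin.suc)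

-- Cyclic order

-- For vertices of Fin k, Betw u x v unfolds to Betwℕ (toℕ u) (toℕ x) (toℕ v).
Betwℕ : ℕ → ℕ → ℕ → Set
Betwℕ a b c = (a < b × b < c) ⊎ (b < c × c < a) ⊎ (c < a × a < b)

Betwℕ-rotate : ∀ {a b c} → Betwℕ a b c → Betwℕ b c a
Betwℕ-rotate (inj₁ abc)        = inj₂ (inj₂ abc)
Betwℕ-rotate (inj₂ (inj₁ bca)) = inj₁ bca
Betwℕ-rotate (inj₂ (inj₂ cab)) = inj₂ (inj₁ cab)

Betwℕ-cong : ∀ {a b c a′ b′ c′} → a ≡ a′ → b ≡ b′ → c ≡ c′ → Betwℕ a b c → Betwℕ a′ b′ c′
Betwℕ-cong refl refl refl abc = abc

record CyclicallyIncreasing (N c : ℕ) (f : ℕ → ℕ) : Set where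
  field
    upper : ∀ {p q} → c ≤ p → p < q → q < N → f p < f q
    lower : ∀ {p q} → p < q → q < c → f p < f q
    wrap  : ∀ {p q} → c ≤ p → p < N → q < c → f p < f q

module _ {N c f} (incr : CyclicallyIncreasing N c f) where
  open CyclicallyIncreasing incr

  private
    increasing⇒Betwℕ : ∀ {a b e} → a < b → b < e → e < N → Betwℕ (f a) (f b) (f e)
    increasing⇒Betwℕ {a} {b} {e} a<b b<e e<N with c ≤? a | c ≤? b | c ≤? e
    ... | yes c≤a | _       | _       = inj₁ (upper c≤a a<b (<-trans b<e e<N) , upper (≤-trans c≤a (<⇒≤ a<b)) b<e e<N)
    ... | no  c>a | yes c≤b | _       = inj₂ (inj₁ (upper c≤b b<e e<N , wrap (≤-trans c≤b (<⇒≤ b<e)) e<N (≰⇒> c>a)))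
    ... | no  c>a | no  c>b | yes c≤e = inj₂ (inj₂ (wrap c≤e e<N (≰⇒> c>a) , lower a<b (≰⇒> c>b)))
    ... | no  _   | no  c>b | no  c>e = inj₁ (lower a<b (≰⇒> c>b) , lower b<e (≰⇒> c>e))

    <⇒image≢ : ∀ {p q} → p < q → q < N → f p ≢ f q
    <⇒image≢ {p} {q} p<q q<N with c ≤? p | c ≤? q
    ... | yes c≤p | _       = <⇒≢ (upper c≤p p<q q<N)
    ... | no  c>p | yes c≤q = <⇒≢ (wrap c≤q q<N (≰⇒> c>p)) ∘ sym
    ... | no  _   | no  c>q = <⇒≢ (lower p<q (≰⇒> c>q))

  preserves-Betwℕ : ∀ {a b e} → a < N → b < N → e < N → Betwℕ a b e → Betwℕ (f a) (f b) (f e)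
  preserves-Betwℕ a<N b<N e<N (inj₁ (a<b , b<e))        = increasing⇒Betwℕ a<b b<e e<N
  preserves-Betwℕ a<N b<N e<N (inj₂ (inj₁ (b<e , e<a))) = Betwℕ-rotate (Betwℕ-rotate (increasing⇒Betwℕ b<e e<a a<N))
  preserves-Betwℕ a<N b<N e<N (inj₂ (inj₂ (e<a , a<b))) = Betwℕ-rotate (increasing⇒Betwℕ e<a a<b b<N)

  injective : ∀ {p q} → p < N → q < N → f p ≡ f q → p ≡ q
  injective {p} {q} p<N q<N fp≡fq with <-cmp p q
  ... | tri< p<q _ _ = ⊥-elim (<⇒image≢ p<q q<N fp≡fq)
  ... | tri≈ _ p≡q _ = p≡q
  ... | tri> _ _ q<p = ⊥-elim (<⇒image≢ q<p p<N (sym fp≡fq))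

∸-split : ∀ {u a b} → u ≤ a → a ≤ b → (b ∸ a) + (a ∸ u) ≡ b ∸ u
∸-split {u} {a} {b} u≤a a≤b = begin
  (b ∸ a) + (a ∸ u) ≡⟨ sym (+-∸-assoc (b ∸ a) u≤a) ⟩
  (b ∸ a) + a ∸ u   ≡⟨ cong (_∸ u) (m∸n+n≡m a≤b) ⟩
  b ∸ u             ∎
  where open ≡-Reasoning

-- The position of z when 0, 1, …, N-1 are read clockwise starting from c.
offset : ℕ → ℕ → ℕ → ℕ
offset N c z with c ≤? z
... | yes _ = z ∸ c
... | no  _ = N ∸ c + z

offset-≥ : ∀ {N c z} → c ≤ z → offset N c z ≡ z ∸ c
offset-≥ {N} {c} {z} c≤z with c ≤? z
... | yes _   = refl
... | no  c>z = ⊥-elim (c>z c≤z)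

offset-< : ∀ {N c z} → z < c → offset N c z ≡ N ∸ c + z
offset-< {N} {c} {z} z<c with c ≤? z
... | yes c≤z = ⊥-elim (<⇒≱ z<c c≤z)
... | no  _   = refl

offset-self : ∀ N c → offset N c c ≡ 0
offset-self N c = trans (offset-≥ {N} {c} ≤-refl) (n∸n≡0 c)

offset<N : ∀ {N c z} → c < N → z < N → offset N c z < N
offset<N {N} {c} {z} c<N z<N with c ≤? z
... | yes _   = ≤-<-trans (m∸n≤m z c) z<N
... | no  c>z = subst (N ∸ c + z <_) (m+[n∸m]≡n′) (+-monoʳ-< (N ∸ c) (≰⇒> c>z))
  where m+[n∸m]≡n′ : N ∸ c + c ≡ N
        m+[n∸m]≡n′ = m∸n+n≡m (<⇒≤ c<N)

offset-increasing : ∀ N c → CyclicallyIncreasing N c (offset N c)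
offset-increasing N c = record { upper = upper ; lower = lower ; wrap = wrap }
  where
  upper : ∀ {p q} → c ≤ p → p < q → q < N → offset N c p < offset N c q
  upper c≤p p<q _ rewrite offset-≥ {N} c≤p | offset-≥ {N} (≤-trans c≤p (<⇒≤ p<q)) = ∸-monoˡ-< p<q c≤p
  lower : ∀ {p q} → p < q → q < c → offset N c p < offset N c q
  lower p<q q<c rewrite offset-< {N} (<-trans p<q q<c) | offset-< {N} q<c = +-monoʳ-< (N ∸ c) p<q
  wrap : ∀ {p q} → c ≤ p → p < N → q < c → offset N c p < offset N c q
  wrap c≤p p<N q<c rewrite offset-≥ {N} c≤p | offset-< {N} q<c = <-≤-trans (∸-monoˡ-< p<N c≤p) (m≤m+n (N ∸ c) _)

offset-trans : ∀ {N u a b} → a < N → b < N → offset N u a ≤ offset N u b →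
  offset N a b + offset N u a ≡ offset N u b
offset-trans {N} {u} {a} {b} a<N b<N ua≤ub with u ≤? a | u ≤? b
... | yes u≤a | yes u≤b =
  trans (cong (_+ (a ∸ u)) (offset-≥ a≤b)) (∸-split u≤a a≤b)
  where a≤b : a ≤ b
        a≤b = ≮⇒≥ λ b<a → <⇒≱ (∸-monoˡ-< b<a u≤b) ua≤ub
... | yes u≤a | no  u>b rewrite offset-< {N} {a} (<-≤-trans (≰⇒> u>b) u≤a) = begin
  N ∸ a + b + (a ∸ u)   ≡⟨ +-assoc (N ∸ a) b _ ⟩
  N ∸ a + (b + (a ∸ u)) ≡⟨ cong (N ∸ a +_) (+-comm b _) ⟩
  N ∸ a + ((a ∸ u) + b) ≡⟨ sym (+-assoc (N ∸ a) _ b) ⟩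
  N ∸ a + (a ∸ u) + b   ≡⟨ cong (_+ b) (∸-split u≤a (<⇒≤ a<N)) ⟩
  N ∸ u + b             ∎
  where open ≡-Reasoning
... | no  u>a | yes u≤b =
  ⊥-elim (<⇒≱ (<-≤-trans (∸-monoˡ-< b<N u≤b) (m≤m+n (N ∸ u) a)) ua≤ub)
... | no  u>a | no  u>b = begin
  offset N a b + (N ∸ u + a) ≡⟨ cong (_+ (N ∸ u + a)) (offset-≥ a≤b) ⟩
  b ∸ a + (N ∸ u + a) ≡⟨ +-comm (b ∸ a) _ ⟩
  N ∸ u + a + (b ∸ a) ≡⟨ +-assoc (N ∸ u) a _ ⟩
  N ∸ u + (a + (b ∸ a)) ≡⟨ cong (N ∸ u +_) (m+[n∸m]≡n a≤b) ⟩
  N ∸ u + b           ∎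
  where open ≡-Reasoning
        a≤b : a ≤ b
        a≤b = +-cancelˡ-≤ (N ∸ u) a b ua≤ub

offset-swap< : ∀ {N a b} → a < b → b < N → offset N a b + offset N b a ≡ N
offset-swap< {N} {a} {b} a<b b<N rewrite offset-≥ {N} (<⇒≤ a<b) | offset-< {N} a<b = begin
  b ∸ a + (N ∸ b + a)   ≡⟨ +-comm (b ∸ a) _ ⟩
  N ∸ b + a + (b ∸ a)   ≡⟨ +-assoc (N ∸ b) a _ ⟩
  N ∸ b + (a + (b ∸ a)) ≡⟨ cong (N ∸ b +_) (m+[n∸m]≡n (<⇒≤ a<b)) ⟩
  N ∸ b + b             ≡⟨ m∸n+n≡m (<⇒≤ b<N) ⟩
  N                     ∎
  where open ≡-Reasoning

offset-swap : ∀ {N a b} → a < N → b < N → a ≢ b → offset N a b + offset N b a ≡ N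
offset-swap {N} {a} {b} a<N b<N a≢b with <-cmp a b
... | tri< a<b _ _ = offset-swap< a<b b<N
... | tri≈ _ a≡b _ = ⊥-elim (a≢b a≡b)
... | tri> _ _ b<a = trans (+-comm (offset N a b) _) (offset-swap< b<a a<N)

dist : ∀ {k} → Fin k → Fin k → ℕ
dist {k} a w = offset k (toℕ a) (toℕ w)

dist<k : ∀ {k} (a w : Fin k) → dist a w < k
dist<k a w = offset<N (toℕ<n a) (toℕ<n w)

dist-self : ∀ {k} (a : Fin k) → dist a a ≡ 0
dist-self {k} a = offset-self k (toℕ a)

dist-injective : ∀ {k} (a : Fin k) {w w′} → dist a w ≡ dist a w′ → w ≡ w′
dist-injective {k} a {w} {w′} = toℕ-injective ∘ injective (offset-increasing k (toℕ a)) (toℕ<n w) (toℕ<n w′)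

dist≡0⇒≡ : ∀ {k} (a w : Fin k) → dist a w ≡ 0 → w ≡ a
dist≡0⇒≡ a w d≡0 = dist-injective a (trans d≡0 (sym (dist-self a)))

dist-preserves-Betw : ∀ {k} (a : Fin k) {u w v} → Betw u w v → Betwℕ (dist a u) (dist a w) (dist a v)
dist-preserves-Betw {k} a {u} {w} {v} = preserves-Betwℕ (offset-increasing k (toℕ a)) (toℕ<n u) (toℕ<n w) (toℕ<n v)

dist-trans : ∀ {k} (u a b : Fin k) → dist u a ≤ dist u b → dist a b + dist u a ≡ dist u b
dist-trans u a b = offset-trans {u = toℕ u} (toℕ<n a) (toℕ<n b)

dist-swap : ∀ {k} (a b : Fin k) → a ≢ b → dist a b + dist b a ≡ k
dist-swap a b a≢b = offset-swap (toℕ<n a) (toℕ<n b) (a≢b ∘ toℕ-injective)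

2≤dist⇒Betw : ∀ {k} (u v : Fin k) → 2 ≤ dist u v → ∃ λ w → Betw u w v
2≤dist⇒Betw {suc k} u v 2≤d with toℕ u ≤? toℕ v
... | yes u≤v = Fin.fromℕ< 1+u<k , inj₁ (u<1+u , 1+u<v)
  where
  1+u<v′ : suc (toℕ u) < toℕ v
  1+u<v′ = subst (2 + toℕ u ≤_) (m∸n+n≡m u≤v) (+-monoˡ-≤ (toℕ u) 2≤d)
  1+u<k : suc (toℕ u) < suc k
  1+u<k = <-trans 1+u<v′ (toℕ<n v)
  u<1+u : toℕ u < toℕ (Fin.fromℕ< 1+u<k)
  u<1+u = subst (toℕ u <_) (sym (toℕ-fromℕ< 1+u<k)) ≤-refl
  1+u<v : toℕ (Fin.fromℕ< 1+u<k) < toℕ v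
  1+u<v = subst (_< toℕ v) (sym (toℕ-fromℕ< 1+u<k)) 1+u<v′
... | no  u>v with suc (toℕ u) <? suc k
...   | yes 1+u<k = Fin.fromℕ< 1+u<k , inj₂ (inj₂ (≰⇒> u>v , subst (toℕ u <_) (sym (toℕ-fromℕ< 1+u<k)) ≤-refl))
...   | no  1+u≮k = zero , inj₂ (inj₁ (0<v , ≰⇒> u>v))
  where
  u≡k : toℕ u ≡ k
  u≡k = ≤-antisym (≤-pred (toℕ<n u)) (≤-pred (≮⇒≥ 1+u≮k))
  0<v : 0 < toℕ v
  0<v = ≤-pred (subst (λ d → 2 ≤ d + toℕ v) (trans (cong (suc k ∸_) u≡k) (m+n∸n≡m 1 k)) 2≤d)

-- Copies and semisaturation

module RelationGraph {R : ℕ → ℕ → Set} (R? : ∀ i j → Dec (R i j)) (R-sym : ∀ {i j} → R i j → R j i) where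

  adjacent? : ∀ {n} (i j : Fin n) → Dec (i ≢ j × R (toℕ i) (toℕ j))
  adjacent? i j = ¬? (i Fin.≟ j) ×-dec R? (toℕ i) (toℕ j)

  graph : ∀ n → COGraph n
  graph n = record
    { adj    = λ i j → ⌊ adjacent? i j ⌋
    ; sym    = λ i j → ⌊⌋-cong (mk⇔ swap swap) (adjacent? i j) (adjacent? j i)
    ; irrefl = λ i → ⌊⌋-false (adjacent? i i) λ (i≢i , _) → i≢i refl
    }
    where
    swap : ∀ {i j : Fin n} → i ≢ j × R (toℕ i) (toℕ j) → j ≢ i × R (toℕ j) (toℕ i)
    swap (i≢j , Rij) = i≢j ∘ sym , R-sym Rij

  adj-intro : ∀ {n} {i j : Fin n} → i ≢ j → R (toℕ i) (toℕ j) → adj (graph n) i j ≡ true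
  adj-intro i≢j Rij = ⌊⌋-true (adjacent? _ _) (i≢j , Rij)

  adj-elim : ∀ {n} {i j : Fin n} → adj (graph n) i j ≡ true → R (toℕ i) (toℕ j)
  adj-elim = proj₂ ∘ ⌊⌋-true⁻¹ (adjacent? _ _)

  nonadj-elim : ∀ {n} {i j : Fin n} → i ≢ j → adj (graph n) i j ≡ false → ¬ R (toℕ i) (toℕ j)
  nonadj-elim i≢j ij∉ Rij = true≢false (trans (sym (adj-intro i≢j Rij)) ij∉)

SameEdge : ∀ {k} → Fin k → Fin k → Fin k → Fin k → Set
SameEdge a b c d = (c ≡ a × d ≡ b) ⊎ (c ≡ b × d ≡ a)

SameEdge-swap : ∀ {k} {a b c d : Fin k} → SameEdge a b c d → SameEdge b a c d
SameEdge-swap (inj₁ ab) = inj₂ ab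
SameEdge-swap (inj₂ ba) = inj₁ ba

module _ {n} (A : Fin n → Fin n → Bool) (x y : Fin n) where

  addEdge-old : ∀ {c d} → A c d ≡ true → addEdge A x y c d ≡ true
  addEdge-old Acd rewrite Acd = refl

  addEdge-new : ∀ {c d} → SameEdge x y c d → addEdge A x y c d ≡ true
  addEdge-new (inj₁ (refl , refl)) rewrite ⌊⌋-true (x Fin.≟ x) refl | ⌊⌋-true (y Fin.≟ y) refl = ∨-zeroʳ (A x y)
  addEdge-new (inj₂ (refl , refl)) rewrite ⌊⌋-true (x Fin.≟ x) refl | ⌊⌋-true (y Fin.≟ y) refl =
    trans (cong (A y x ∨_) (∨-zeroʳ _)) (∨-zeroʳ (A y x))

  addEdge-comm : ∀ c d → addEdge A x y c d ≡ addEdge A y x c d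
  addEdge-comm c d = cong (A c d ∨_) (∨-comm (⌊ c Fin.≟ x ⌋ ∧ ⌊ d Fin.≟ y ⌋) _)

  addEdge⇒SameEdge : ∀ {c d} → A c d ≡ false → addEdge A x y c d ≡ true → SameEdge x y c d
  addEdge⇒SameEdge {c} {d} Acd≡false new rewrite Acd≡false with c Fin.≟ x | d Fin.≟ y | c Fin.≟ y | d Fin.≟ x
  ... | yes c≡x | yes d≡y | _       | _       = inj₁ (c≡x , d≡y)
  ... | _       | _       | yes c≡y | yes d≡x = inj₂ (c≡y , d≡x)
  ... | no  _   | _       | no  _   | _       = ⊥-elim (true≢false (sym new))
  ... | no  _   | _       | yes _   | no  _   = ⊥-elim (true≢false (sym new))
  ... | yes _   | no  _   | no  _   | _       = ⊥-elim (true≢false (sym new))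
  ... | yes _   | no  _   | yes _   | no  _   = ⊥-elim (true≢false (sym new))

IsCyclicEmbedding : ∀ {k n} → (Fin k → Fin n) → Set
IsCyclicEmbedding φ = (∀ u v → φ u ≡ φ v → u ≡ v) × (∀ u x v → Betw u x v → Betw (φ u) (φ x) (φ v))

edge⇒≢ : ∀ {k} (C : COGraph k) {c d} → adj C c d ≡ true → c ≢ d
edge⇒≢ C {c} cd refl = true≢false (trans (sym cd) (adj-irrefl C c))

embedding-edge⇒≢ : ∀ {k n} (C : COGraph k) {φ : Fin k → Fin n} → IsCyclicEmbedding φ →
  ∀ {c d} → adj C c d ≡ true → φ c ≢ φ d
embedding-edge⇒≢ C (injective , _) {c} {d} cd = edge⇒≢ C cd ∘ injective c d

NewCopy : ∀ {k n} → COGraph k → COGraph n → Fin n → Fin n → Set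
NewCopy {k} {n} C H x y =
  Σ (Fin k → Fin n) λ φ → IsCopy C (addEdge (adj H) x y) φ × ¬ IsCopy C (adj H) φ

semisaturates-ordered : ∀ {k n} (C : COGraph k) (H : COGraph n) →
  (∀ x y → toℕ x < toℕ y → adj H x y ≡ false → NewCopy C H x y) → Semisaturates H C
semisaturates-ordered C H new x y x≢y xy∉H with <-cmp (toℕ x) (toℕ y)
... | tri< x<y _ _ = new x y x<y xy∉H
... | tri≈ _ x≡y _ = ⊥-elim (x≢y (toℕ-injective x≡y))
... | tri> _ _ y<x with new y x y<x (trans (adj-sym H y x) xy∉H)
...   | φ , (injective , betw , edge) , old =
  φ , (injective , betw , λ c d cd → trans (addEdge-comm (adj H) x y (φ c) (φ d)) (edge c d cd)) , old

new-copy : ∀ {k n} (C : COGraph k) (H : COGraph n) {x y} (φ : Fin k → Fin n) {a b} →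
  IsCyclicEmbedding φ → adj C a b ≡ true → φ a ≡ x → φ b ≡ y → adj H x y ≡ false →
  (∀ c d → adj C c d ≡ true → SameEdge a b c d ⊎ adj H (φ c) (φ d) ≡ true) →
  NewCopy C H x y
new-copy C H {x} {y} φ {a} {b} (injective , betw) ab φa≡x φb≡y xy∉H other =
  φ , (injective , betw , edge) , not-old
  where
  not-old : ¬ IsCopy C (adj H) φ
  not-old (_ , _ , old) =
    true≢false (trans (sym (old a b ab)) (subst₂ (λ p q → adj H p q ≡ false) (sym φa≡x) (sym φb≡y) xy∉H))
  edge : ∀ c d → adj C c d ≡ true → addEdge (adj H) x y (φ c) (φ d) ≡ true
  edge c d cd with other c d cd
  ... | inj₁ (inj₁ (refl , refl)) = addEdge-new (adj H) x y (inj₁ (φa≡x , φb≡y))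
  ... | inj₁ (inj₂ (refl , refl)) = addEdge-new (adj H) x y (inj₂ (φb≡y , φa≡x))
  ... | inj₂ φcφd∈H               = addEdge-old (adj H) x y φcφd∈H

edge-preserved? : ∀ {k n} (C : COGraph k) (A : Fin n → Fin n → Bool) (φ : Fin k → Fin n) a b →
  Dec (adj C a b ≡ true → A (φ a) (φ b) ≡ true)
edge-preserved? C A φ a b = (adj C a b Bool.≟ true) →-dec (A (φ a) (φ b) Bool.≟ true)

missing-edge : ∀ {k n} (C : COGraph k) (A : Fin n → Fin n → Bool) (φ : Fin k → Fin n) →
  IsCyclicEmbedding φ → ¬ IsCopy C A φ → ∃ λ a → ∃ λ b → adj C a b ≡ true × A (φ a) (φ b) ≡ false
missing-edge {k} C A φ (injective , betw) not-copy
  with FinP.¬∀⟶∃¬ k _ (FinP.all? ∘ edge-preserved? C A φ) (λ all → not-copy (injective , betw , all))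
... | a , ¬all with FinP.¬∀⟶∃¬ k _ (edge-preserved? C A φ a) ¬all
...   | b , ¬preserved with adj C a b in ab | A (φ a) (φ b) in φaφb
...     | true  | false = a , b , ab , φaφb
...     | true  | true  = ⊥-elim (¬preserved λ _ → refl)
...     | false | _     = ⊥-elim (¬preserved λ ())

-- The lower bound

module _ {k n} (C : COGraph k) (H : COGraph n) {x y : Fin n} (x≢y : x ≢ y) (gap : IntervalEmpty x y)
         (x-isolated : degree H x ≡ 0) (y-isolated : degree H y ≡ 0) where

  edge-onto-isolated-gap⇒minedge : ∀ {φ} → IsCopy C (addEdge (adj H) x y) φ →
    ∀ {a b} → adj C a b ≡ true → φ a ≡ x → φ b ≡ y → IsMinedge C a b
  edge-onto-isolated-gap⇒minedge {φ} (injective , betw , edge) {a} {b} ab φa≡x φb≡y =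
    ab , inj₁ ab-gap , unique⇒count≡1 (adj C a) b ab only-b , unique⇒count≡1 (adj C b) a ba only-a
    where
    ba : adj C b a ≡ true
    ba = trans (adj-sym C b a) ab
    ab-gap : IntervalEmpty a b
    ab-gap w a<w<b = gap (φ w) (subst₂ (λ p q → Betw p (φ w) q) φa≡x φb≡y (betw a w b a<w<b))
    edge-at-isolated : ∀ {z c} w → degree H z ≡ 0 → φ c ≡ z → adj C c w ≡ true → SameEdge x y z (φ w)
    edge-at-isolated w z-isolated refl cw =
      addEdge⇒SameEdge (adj H) x y (count≡0⇒false (adj H _) z-isolated (φ w)) (edge _ w cw)
    only-b : ∀ w → adj C a w ≡ true → w ≡ b
    only-b w aw with edge-at-isolated w x-isolated φa≡x aw
    ... | inj₁ (_ , φw≡y) = injective w b (trans φw≡y (sym φb≡y))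
    ... | inj₂ (x≡y , _)  = ⊥-elim (x≢y x≡y)
    only-a : ∀ w → adj C b w ≡ true → w ≡ a
    only-a w bw with edge-at-isolated w y-isolated φb≡y bw
    ... | inj₁ (y≡x , _)  = ⊥-elim (x≢y (sym y≡x))
    ... | inj₂ (_ , φw≡x) = injective w a (trans φw≡x (sym φa≡x))

  isolated-gap⇒minedge : Semisaturates H C → HasMinedge C
  isolated-gap⇒minedge semisat with semisat x y x≢y (count≡0⇒false (adj H x) x-isolated y)
  ... | φ , copy@(injective , betw , edge) , not-old with missing-edge C (adj H) φ (injective , betw) not-old
  ...   | a , b , ab , φaφb∉H with addEdge⇒SameEdge (adj H) x y φaφb∉H (edge a b ab)
  ...     | inj₁ (φa≡x , φb≡y) = a , b , edge-onto-isolated-gap⇒minedge copy ab φa≡x φb≡y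
  ...     | inj₂ (φa≡y , φb≡x) = b , a , edge-onto-isolated-gap⇒minedge copy (trans (adj-sym C b a) ab) φb≡x φa≡y

consecutive-gap : ∀ {n} (i : Fin n) → IntervalEmpty (Fin.inject₁ i) (suc i)
consecutive-gap i w between rewrite FinP.toℕ-inject₁ i with between
... | inj₁ (i<w , w<1+i)        = <-irrefl refl (<-≤-trans i<w (≤-pred w<1+i))
... | inj₂ (inj₁ (_ , 1+i<i))   = <-irrefl refl (<-trans 1+i<i (n<1+n _))
... | inj₂ (inj₂ (1+i<i , _))   = <-irrefl refl (<-trans 1+i<i (n<1+n _))

consecutive-≢ : ∀ {n} (i : Fin n) → Fin.inject₁ i ≢ suc i
consecutive-≢ i e = <-irrefl (trans (sym (FinP.toℕ-inject₁ i)) (cong toℕ e)) (n<1+n _)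

≤4e+1⇒≤5e : ∀ {m} e → 2 ≤ m → m ≤ 2 * (2 * e) + 1 → m ≤ 5 * e
≤4e+1⇒≤5e zero    2≤m m≤1 = ⊥-elim (<-irrefl refl (≤-trans 2≤m m≤1))
≤4e+1⇒≤5e (suc e) _   m≤  = ≤-trans m≤ (≤-trans (m≤m+n _ e) (≤-reflexive
  (solve 1 (λ e → con 2 :* (con 2 :* (con 1 :+ e)) :+ con 1 :+ e := con 5 :* (con 1 :+ e)) refl e)))
  where open +-*-Solver

ssat-lower : ∀ {k} (C : COGraph k) → ¬ HasMinedge C → SsatLowerLinear C
ssat-lower C no-minedge = 5 , 2 , bound
  where
  bound : ∀ n → 2 ≤ n → (H : COGraph n) → Semisaturates H C → n ≤ 5 * edges H
  bound (suc n) 2≤n H semisat = ≤4e+1⇒≤5e (edges H) 2≤n (begin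
    suc n                             ≤⟨ consecutive-cover n (degree H) not-both-isolated ⟩
    2 * ∑[ i < suc n ] degree H i + 1 ≤⟨ +-monoˡ-≤ 1 (*-monoʳ-≤ 2 (handshake H)) ⟩
    2 * (2 * edges H) + 1             ∎)
    where
    open ≤-Reasoning
    not-both-isolated : ∀ i → 1 ≤ degree H (Fin.inject₁ i) + degree H (suc i)
    not-both-isolated i with degree H (Fin.inject₁ i) in d₁ | degree H (suc i) in d₂
    ... | zero  | zero  = ⊥-elim (no-minedge (isolated-gap⇒minedge C H (consecutive-≢ i) (consecutive-gap i) d₁ d₂ semisat))
    ... | suc _ | _     = s≤s z≤n
    ... | zero  | suc _ = s≤s z≤n

-- The constructions

-- Reading C clockwise from a, the vertices before b go to o, o+1, …, b goes to t,
-- and the K = k-1-ℓ vertices after b go to 0, 1, …, K-1.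
module Layout {k n} (a b : Fin k) (o t : Fin n) (a≢b : a ≢ b)
              (K≤o : k ∸ suc (dist a b) ≤ toℕ o) (o+ℓ≤t : toℕ o + dist a b ≤ toℕ t) where

  ℓ K : ℕ
  ℓ = dist a b
  K = k ∸ suc ℓ

  place : ℕ → ℕ
  place i with <-cmp i ℓ
  ... | tri< _ _ _ = toℕ o + i
  ... | tri≈ _ _ _ = toℕ t
  ... | tri> _ _ _ = i ∸ suc ℓ

  place-< : ∀ {i} → i < ℓ → place i ≡ toℕ o + i
  place-< {i} i<ℓ with <-cmp i ℓ
  ... | tri< _ _ _    = refl
  ... | tri≈ i≮ℓ _ _  = ⊥-elim (i≮ℓ i<ℓ)
  ... | tri> i≮ℓ _ _  = ⊥-elim (i≮ℓ i<ℓ)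

  place-≡ : ∀ {i} → i ≡ ℓ → place i ≡ toℕ t
  place-≡ {i} i≡ℓ with <-cmp i ℓ
  ... | tri< _ i≢ℓ _ = ⊥-elim (i≢ℓ i≡ℓ)
  ... | tri≈ _ _ _   = refl
  ... | tri> _ i≢ℓ _ = ⊥-elim (i≢ℓ i≡ℓ)

  place-> : ∀ {i} → ℓ < i → place i ≡ i ∸ suc ℓ
  place-> {i} ℓ<i with <-cmp i ℓ
  ... | tri< _ _ i≯ℓ = ⊥-elim (i≯ℓ ℓ<i)
  ... | tri≈ _ _ i≯ℓ = ⊥-elim (i≯ℓ ℓ<i)
  ... | tri> _ _ _   = refl

  place-beyond : ∀ {i} → ℓ < i → i < k → place i < K
  place-beyond ℓ<i i<k rewrite place-> ℓ<i = ∸-monoˡ-< i<k ℓ<i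

  o+i≤place : ∀ {i} → i ≤ ℓ → toℕ o + i ≤ place i
  o+i≤place {i} i≤ℓ with m≤n⇒m<n∨m≡n i≤ℓ
  ... | inj₁ i<ℓ  = ≤-reflexive (sym (place-< i<ℓ))
  ... | inj₂ refl = ≤-trans o+ℓ≤t (≤-reflexive (sym (place-≡ refl)))

  place-increasing : CyclicallyIncreasing k (suc ℓ) place
  place-increasing = record { upper = upper ; lower = lower ; wrap = wrap }
    where
    upper : ∀ {p q} → suc ℓ ≤ p → p < q → q < k → place p < place q
    upper ℓ<p p<q _ rewrite place-> ℓ<p | place-> (<-trans ℓ<p p<q) = ∸-monoˡ-< p<q ℓ<p
    lower : ∀ {p q} → p < q → q < suc ℓ → place p < place q
    lower p<q q≤ℓ rewrite place-< (<-≤-trans p<q (≤-pred q≤ℓ)) =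
      <-≤-trans (+-monoʳ-< (toℕ o) p<q) (o+i≤place (≤-pred q≤ℓ))
    wrap : ∀ {p q} → suc ℓ ≤ p → p < k → q < suc ℓ → place p < place q
    wrap ℓ<p p<k q≤ℓ =
      <-≤-trans (place-beyond ℓ<p p<k) (≤-trans K≤o (≤-trans (m≤m+n _ _) (o+i≤place (≤-pred q≤ℓ))))

  place-before : ∀ {i} → i < k → i ≢ ℓ → place i < toℕ o + ℓ
  place-before {i} i<k i≢ℓ with <-cmp i ℓ
  ... | tri< i<ℓ _ _ = +-monoʳ-< (toℕ o) i<ℓ
  ... | tri≈ _ i≡ℓ _ = ⊥-elim (i≢ℓ i≡ℓ)
  ... | tri> _ _ ℓ<i = <-≤-trans (∸-monoˡ-< i<k ℓ<i) (≤-trans K≤o (m≤m+n _ ℓ))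

  place≤t : ∀ {i} → i < k → place i ≤ toℕ t
  place≤t {i} i<k = case i ≟ ℓ of λ where
    (yes i≡ℓ) → ≤-reflexive (place-≡ i≡ℓ)
    (no  i≢ℓ) → ≤-trans (<⇒≤ (place-before i<k i≢ℓ)) o+ℓ≤t

  φ : Fin k → Fin n
  φ w = Fin.fromℕ< (≤-<-trans (place≤t (dist<k a w)) (toℕ<n t))

  toℕ-φ : ∀ w → toℕ (φ w) ≡ place (dist a w)
  toℕ-φ w = toℕ-fromℕ< _

  φ-embedding : IsCyclicEmbedding φ
  φ-embedding = φ-injective , φ-betw
    where
    φ-injective : ∀ u v → φ u ≡ φ v → u ≡ v
    φ-injective u v φu≡φv = dist-injective a (injective place-increasing (dist<k a u) (dist<k a v)
      (trans (sym (toℕ-φ u)) (trans (cong toℕ φu≡φv) (toℕ-φ v))))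
    φ-betw : ∀ u x v → Betw u x v → Betw (φ u) (φ x) (φ v)
    φ-betw u x v uxv = Betwℕ-cong (sym (toℕ-φ u)) (sym (toℕ-φ x)) (sym (toℕ-φ v))
      (preserves-Betwℕ place-increasing (dist<k a u) (dist<k a x) (dist<k a v) (dist-preserves-Betw a uxv))

  φ-a : φ a ≡ o
  φ-a = toℕ-injective (begin
    toℕ (φ a)          ≡⟨ toℕ-φ a ⟩
    place (dist a a)   ≡⟨ cong place (dist-self a) ⟩
    place 0            ≡⟨ place-< (n≢0⇒n>0 λ ℓ≡0 → a≢b (sym (dist≡0⇒≡ a b ℓ≡0))) ⟩
    toℕ o + 0          ≡⟨ +-identityʳ _ ⟩
    toℕ o              ∎)
    where open ≡-Reasoning

  φ-b : φ b ≡ t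
  φ-b = toℕ-injective (trans (toℕ-φ b) (place-≡ refl))

  φ-beyond : ∀ w → ℓ < dist a w → toℕ (φ w) < K
  φ-beyond w ℓ<d = subst (_< K) (sym (toℕ-φ w)) (place-beyond ℓ<d (dist<k a w))

  φ-before : ∀ w → w ≢ b → toℕ (φ w) < toℕ o + ℓ
  φ-before w w≢b = subst (_< toℕ o + ℓ) (sym (toℕ-φ w)) (place-before (dist<k a w) (w≢b ∘ dist-injective a))

∸1≡1+∸2 : ∀ m → 0 < m ∸ 2 → m ∸ 1 ≡ suc (m ∸ 2)
∸1≡1+∸2 (suc (suc m)) _ = refl

module MinedgeClique {k} (C : COGraph k) {u v : Fin k} (uv : adj C u v ≡ true) (gap : IntervalEmpty u v)
                           (deg-u : degree C u ≡ 1) (deg-v : degree C v ≡ 1) where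

  s M : ℕ
  s = k ∸ 2
  M = s + s

  open RelationGraph {λ i j → i < M × j < M} (λ i j → (i <? M) ×-dec (j <? M)) (λ (i<M , j<M) → j<M , i<M) public

  vu : adj C v u ≡ true
  vu = trans (adj-sym C v u) uv

  dist-uv : dist u v ≡ 1
  dist-uv with dist u v in d
  ... | zero          = ⊥-elim (edge⇒≢ C uv (sym (dist≡0⇒≡ u v d)))
  ... | suc zero      = refl
  ... | suc (suc _)   = ⊥-elim (let (w , u<w<v) = 2≤dist⇒Betw u v (subst (2 ≤_) (sym d) (s≤s (s≤s z≤n))) in gap w u<w<v)

  dist-vu : dist v u ≡ k ∸ 1
  dist-vu = begin
    dist v u                  ≡⟨ sym (m+n∸m≡n 1 (dist v u)) ⟩
    1 + dist v u ∸ 1          ≡⟨ cong (λ d → d + dist v u ∸ 1) (sym dist-uv) ⟩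
    dist u v + dist v u ∸ 1   ≡⟨ cong (_∸ 1) (dist-swap u v (edge⇒≢ C uv)) ⟩
    k ∸ 1                     ∎
    where open ≡-Reasoning

  Outside : Fin k → Set
  Outside w = w ≢ u × w ≢ v

  edge-cases : ∀ c d → adj C c d ≡ true → SameEdge u v c d ⊎ (Outside c × Outside d)
  edge-cases c d cd with c Fin.≟ u | c Fin.≟ v | d Fin.≟ u | d Fin.≟ v
  ... | yes refl | _        | _        | _        = inj₁ (inj₁ (refl , count≡1⇒unique (adj C u) deg-u d v cd uv))
  ... | no  _    | yes refl | _        | _        = inj₁ (inj₂ (refl , count≡1⇒unique (adj C v) deg-v d u cd vu))
  ... | no  c≢u  | no  c≢v  | yes refl | _        =
    ⊥-elim (c≢v (count≡1⇒unique (adj C u) deg-u c v (trans (adj-sym C u c) cd) uv))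
  ... | no  c≢u  | no  _    | no  _    | yes refl =
    ⊥-elim (c≢u (count≡1⇒unique (adj C v) deg-v c u (trans (adj-sym C v c) cd) vu))
  ... | no  c≢u  | no  c≢v  | no  d≢u  | no  d≢v  = inj₂ ((c≢u , c≢v) , (d≢u , d≢v))

  outside⇒1<dist : ∀ {w} → Outside w → 1 < dist u w
  outside⇒1<dist {w} (w≢u , w≢v) with dist u w in d
  ... | zero        = ⊥-elim (w≢u (dist≡0⇒≡ u w d))
  ... | suc zero    = ⊥-elim (w≢v (dist-injective u (trans d (sym dist-uv))))
  ... | suc (suc _) = s≤s (s≤s z≤n)

  M≤y : ∀ {n} {x y : Fin n} → toℕ x < toℕ y → adj (graph n) x y ≡ false → M ≤ toℕ y
  M≤y x<y xy∉H = ≮⇒≥ λ y<M → nonadj-elim (<⇒≢ x<y ∘ cong toℕ) xy∉H (<-trans x<y y<M , y<M)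

  -- If s ≤ x, the s vertices outside {u,v} go to 0, …, s-1.
  new-copy-far : ∀ {n} (x y : Fin n) → s ≤ toℕ x → toℕ x < toℕ y → adj (graph n) x y ≡ false →
    NewCopy C (graph n) x y
  new-copy-far {n} x y s≤x x<y xy∉H = new-copy C (graph n) φ φ-embedding uv φ-a φ-b xy∉H other
    where
    open Layout u v x y (edge⇒≢ C uv) (subst (λ ℓ → k ∸ suc ℓ ≤ toℕ x) (sym dist-uv) s≤x)
                        (subst (λ ℓ → toℕ x + ℓ ≤ toℕ y) (sym dist-uv) (subst (_≤ toℕ y) (+-comm 1 _) x<y))
    φ<M : ∀ {c} → Outside c → toℕ (φ c) < M
    φ<M c-out = <-≤-trans (φ-beyond _ (subst (_< dist u _) (sym dist-uv) (outside⇒1<dist c-out)))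
                          (subst (λ ℓ → k ∸ suc ℓ ≤ M) (sym dist-uv) (m≤m+n s s))
    other : ∀ c d → adj C c d ≡ true → SameEdge u v c d ⊎ adj (graph n) (φ c) (φ d) ≡ true
    other c d cd = Sum.map₂ (λ (c-out , d-out) → adj-intro (embedding-edge⇒≢ C φ-embedding cd) (φ<M c-out , φ<M d-out))
                            (edge-cases c d cd)

  -- Otherwise they go to x+1, …, x+s, which lie in the clique and before y.
  new-copy-near : ∀ {n} (x y : Fin n) → toℕ x < s → toℕ x < toℕ y → adj (graph n) x y ≡ false →
    NewCopy C (graph n) x y
  new-copy-near {n} x y x<s x<y xy∉H = new-copy C (graph n) φ φ-embedding vu φ-a φ-b xy∉H other
    where
    x+ℓ≤M : toℕ x + dist v u ≤ M
    x+ℓ≤M = begin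
      toℕ x + dist v u     ≡⟨ cong (toℕ x +_) (trans dist-vu (∸1≡1+∸2 k (≤-<-trans z≤n x<s))) ⟩
      toℕ x + suc s        ≡⟨ +-suc (toℕ x) s ⟩
      suc (toℕ x) + s      ≤⟨ +-monoˡ-≤ s x<s ⟩
      M                    ∎
      where open ≤-Reasoning
    nothing-after-u : k ∸ suc (dist v u) ≡ 0
    nothing-after-u = trans (cong (λ ℓ → k ∸ suc ℓ) dist-vu) (m≤n⇒m∸n≡0 (m≤n+m∸n k 1))
    open Layout v u x y (edge⇒≢ C vu) (subst (_≤ toℕ x) (sym nothing-after-u) z≤n) (≤-trans x+ℓ≤M (M≤y x<y xy∉H))
    other : ∀ c d → adj C c d ≡ true → SameEdge v u c d ⊎ adj (graph n) (φ c) (φ d) ≡ true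
    other c d cd = Sum.map SameEdge-swap
      (λ ((c≢u , _) , (d≢u , _)) → adj-intro (embedding-edge⇒≢ C φ-embedding cd)
                                             (<-≤-trans (φ-before c c≢u) x+ℓ≤M , <-≤-trans (φ-before d d≢u) x+ℓ≤M))
      (edge-cases c d cd)

  semisaturates : ∀ n → Semisaturates (graph n) C
  semisaturates n = semisaturates-ordered C (graph n) λ x y x<y xy∉H → case s ≤? toℕ x of λ where
    (yes s≤x) → new-copy-far x y s≤x x<y xy∉H
    (no  s>x) → new-copy-near x y (≰⇒> s>x) x<y xy∉H

  edges≤M*M : ∀ n → edges (graph n) ≤ M * M
  edges≤M*M n = subst (edges (graph n) ≤_) (trans (cong (M * M +_) (*-zeroʳ n)) (+-identityʳ _))
    (edges-≤ (graph n) M M 0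
      (λ i _   → count-within 0 M (forward (graph n) i) λ j p → z≤n , proj₂ (forward-adj p))
      (λ i M≤i → count-within 0 0 (forward (graph n) i) λ j p → ⊥-elim (≤⇒≯ M≤i (proj₁ (forward-adj p)))))
    where
    forward-adj : ∀ {i j} → forward (graph n) i j ≡ true → toℕ i < M × toℕ j < M
    forward-adj = adj-elim ∘ proj₂ ∘ ∧-true

ssat-bounded : ∀ {k} (C : COGraph k) → HasMinedge C → SsatBounded C
ssat-bounded C (u , v , uv , inj₁ gap , deg-u , deg-v) = M * M , λ n → graph n , semisaturates n , edges≤M*M n
  where open MinedgeClique C uv gap deg-u deg-v
ssat-bounded C (u , v , uv , inj₂ gap , deg-u , deg-v) = M * M , λ n → graph n , semisaturates n , edges≤M*M n
  where open MinedgeClique C (trans (adj-sym C v u) uv) gap deg-v deg-u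

shortest-edge : ∀ {k} (C : COGraph k) → HasEdge C →
  ∃ λ u → ∃ λ v → adj C u v ≡ true × (∀ a b → adj C a b ≡ true → dist u v ≤ dist a b)
shortest-edge {k} C (a , b , ab) = search (dist a b) a b ab ≤-refl
  where
  search : ∀ m a b → adj C a b ≡ true → dist a b ≤ m →
    ∃ λ u → ∃ λ v → adj C u v ≡ true × (∀ a b → adj C a b ≡ true → dist u v ≤ dist a b)
  search zero    a b ab ab≤0 = a , b , ab , λ _ _ _ → ≤-trans ab≤0 z≤n
  search (suc m) a b ab ab≤m+1 with FinP.any? (λ c → FinP.any? λ d → (adj C c d Bool.≟ true) ×-dec (dist c d ≤? m))
  ... | yes (c , d , cd , cd≤m) = search m c d cd cd≤m
  ... | no  none                = a , b , ab , λ c d cd → ≤-trans ab≤m+1 (≰⇒> λ cd≤m → none (c , d , cd , cd≤m))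

module ShortestEdgeBand {k} (C : COGraph k) {u v : Fin k} (uv : adj C u v ≡ true)
                                (shortest : ∀ a b → adj C a b ≡ true → dist u v ≤ dist a b) where

  ℓ K : ℕ
  ℓ = dist u v
  K = k ∸ suc ℓ

  Near : ℕ → ℕ → Set
  Near i j = i < K ⊎ j < K ⊎ (i < j + ℓ × j < i + ℓ)

  near? : ∀ i j → Dec (Near i j)
  near? i j = (i <? K) ⊎-dec (j <? K) ⊎-dec ((i <? j + ℓ) ×-dec (j <? i + ℓ))

  near-sym : ∀ {i j} → Near i j → Near j i
  near-sym (inj₁ i<K)               = inj₂ (inj₁ i<K)
  near-sym (inj₂ (inj₁ j<K))        = inj₁ j<K
  near-sym (inj₂ (inj₂ (i<j+ℓ , j<i+ℓ))) = inj₂ (inj₂ (j<i+ℓ , i<j+ℓ))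

  open RelationGraph near? near-sym public

  ordered-edge-within : ∀ {c d} → adj C c d ≡ true → dist u c < dist u d → dist u d ≤ ℓ → c ≡ u × d ≡ v
  ordered-edge-within {c} {d} cd uc<ud ud≤ℓ =
    dist≡0⇒≡ u c uc≡0 , dist-injective u (≤-antisym ud≤ℓ (≤-trans (m≤m+n ℓ _) ℓ+uc≤ud))
    where
    ℓ+uc≤ud : ℓ + dist u c ≤ dist u d
    ℓ+uc≤ud = subst (ℓ + dist u c ≤_) (dist-trans u c d (<⇒≤ uc<ud)) (+-monoˡ-≤ (dist u c) (shortest c d cd))
    uc≡0 : dist u c ≡ 0
    uc≡0 = n≤0⇒n≡0 (+-cancelˡ-≤ ℓ _ 0 (subst (ℓ + dist u c ≤_) (sym (+-identityʳ ℓ)) (≤-trans ℓ+uc≤ud ud≤ℓ)))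

  edge-within⇒SameEdge : ∀ {c d} → adj C c d ≡ true → dist u c ≤ ℓ → dist u d ≤ ℓ → SameEdge u v c d
  edge-within⇒SameEdge {c} {d} cd uc≤ℓ ud≤ℓ with <-cmp (dist u c) (dist u d)
  ... | tri< uc<ud _ _ = inj₁ (ordered-edge-within cd uc<ud ud≤ℓ)
  ... | tri≈ _ uc≡ud _ = ⊥-elim (edge⇒≢ C cd (dist-injective u uc≡ud))
  ... | tri> _ _ ud<uc = let (d≡u , c≡v) = ordered-edge-within (trans (adj-sym C d c) cd) ud<uc uc≤ℓ in inj₂ (c≡v , d≡u)

  semisaturates : ∀ n → Semisaturates (graph n) C
  semisaturates n = semisaturates-ordered C (graph n) new
    where
    new : ∀ x y → toℕ x < toℕ y → adj (graph n) x y ≡ false → NewCopy C (graph n) x y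
    new x y x<y xy∉H = new-copy C (graph n) φ φ-embedding uv φ-a φ-b xy∉H other
      where
      far : ¬ Near (toℕ x) (toℕ y)
      far = nonadj-elim (<⇒≢ x<y ∘ cong toℕ) xy∉H
      open Layout u v x y (edge⇒≢ C uv) (≮⇒≥ (far ∘ inj₁))
                  (≮⇒≥ λ y<x+ℓ → far (inj₂ (inj₂ (<-≤-trans x<y (m≤m+n _ ℓ) , y<x+ℓ))))
        using (φ; φ-embedding; φ-a; φ-b; φ-beyond)
      other : ∀ c d → adj C c d ≡ true → SameEdge u v c d ⊎ adj (graph n) (φ c) (φ d) ≡ true
      other c d cd = by-position (dist u c ≤? ℓ) (dist u d ≤? ℓ)
        where
        φc≢φd : φ c ≢ φ d
        φc≢φd = embedding-edge⇒≢ C φ-embedding cd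
        by-position : Dec (dist u c ≤ ℓ) → Dec (dist u d ≤ ℓ) → SameEdge u v c d ⊎ adj (graph n) (φ c) (φ d) ≡ true
        by-position (yes uc≤ℓ) (yes ud≤ℓ) = inj₁ (edge-within⇒SameEdge cd uc≤ℓ ud≤ℓ)
        by-position (no  uc≰ℓ) _          = inj₂ (adj-intro φc≢φd (inj₁ (φ-beyond c (≰⇒> uc≰ℓ))))
        by-position _          (no ud≰ℓ)  = inj₂ (adj-intro φc≢φd (inj₂ (inj₁ (φ-beyond d (≰⇒> ud≰ℓ)))))

  forward-within : ∀ {n} {i j : Fin n} → K ≤ toℕ i → forward (graph n) i j ≡ true →
    toℕ i ≤ toℕ j × toℕ j < toℕ i + ℓ
  forward-within {i = i} {j} K≤i ij with ∧-true ij
  ... | i<?j , ij∈H with adj-elim ij∈H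
  ...   | inj₁ i<K = ⊥-elim (≤⇒≯ K≤i i<K)
  ...   | inj₂ (inj₁ j<K) = ⊥-elim (≤⇒≯ K≤i (<-trans (⌊⌋-true⁻¹ (i Fin.<? j) i<?j) j<K))
  ...   | inj₂ (inj₂ (_ , j<i+ℓ)) = <⇒≤ (⌊⌋-true⁻¹ (i Fin.<? j) i<?j) , j<i+ℓ

  edges≤[K+ℓ]*n : ∀ n → edges (graph n) ≤ (K + ℓ) * n
  edges≤[K+ℓ]*n n = subst (edges (graph n) ≤_) (trans (cong (K * n +_) (*-comm n ℓ)) (sym (*-distribʳ-+ n K ℓ)))
    (edges-≤ (graph n) K n ℓ (λ i _ → count-≤ (forward (graph n) i))
                             (λ i K≤i → count-within (toℕ i) ℓ (forward (graph n) i) λ j → forward-within K≤i))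

ssat-upper : ∀ {k} (C : COGraph k) → HasEdge C → SsatUpperLinear C
ssat-upper C has-edge with shortest-edge C has-edge
... | u , v , uv , shortest = K + ℓ , 0 , λ n _ → graph n , semisaturates n , edges≤[K+ℓ]*n n
  where open ShortestEdgeBand C uv shortest

theorem10 : ∀ {k} (C : COGraph k) → HasEdge C →
    (HasMinedge C → SsatBounded C)
    × (¬ HasMinedge C → SsatUpperLinear C × SsatLowerLinear C)
theorem10 C has-edge = ssat-bounded C , λ no-minedge → ssat-upper C has-edge , ssat-lower C no-minedge
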